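{- Let $G=(V,E)$ be a finite undirected bi-connected graph, and let $s_1,s_2\in V$ with $(s_1,s_2)\in E$. Let $C_1,\dots,C_k$ be the connected components of the graph obtained from $G$ by deleting $s_1$, $s_2$ and all edges incident to them. Fix $1\le i\le k$ and let $B$ be a leaf block of $C_i$. Then $|B\cap N_{s_1}|+|B\cap N_{s_2}|\ge 1$.
   Context: A graph is bi-connected if it is connected and has no articulation point (cut vertex). For a vertex $v$, $N_v$ denotes the set of neighbours of $v$ in $G$. A block of a graph is a maximal bi-connected subgraph. The block tree of $C_i$ is the bipartite graph whose vertices are the blocks and the articulation points of $C_i$, a block being adjacent to an articulation point iff it contains it; a leaf block is a block that is a leaf of this block tree (so it contains at most one articulation point of $C_i$). Here $B$ is viewed as a vertex set when intersecting with $N_{s_1}, N_{s_2}$. -}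

module Defs where

open import Data.Nat using (ℕ)
open import Data.Fin using (Fin)
open import Data.Fin.Subset using (Subset; _∈_; _∉_; _⊆_; _-_; ⊤)
open import Data.Vec using (tabulate)
open import Data.Product using (_×_; ∃; ∃₂)
open import Relation.Nullary using (¬_; Dec; does)
open import Relation.Binary.PropositionalEquality using (_≡_; _≢_)

record Graph (n : ℕ) : Set₁ where
  field
    E      : Fin n → Fin n → Set
    E?     : ∀ u v → Dec (E u v)
    E-sym  : ∀ {u v} → E u v → E v u
    E-irr  : ∀ {u} → ¬ E u u

module _ {n : ℕ} (G : Graph n) where
  open Graph G

  data Walk (S : Subset n) : Fin n → Fin n → Set where
    stay : ∀ {u} → u ∈ S → Walk S u u
    step : ∀ {u w v} → u ∈ S → E u w → Walk S w v → Walk S u v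

  Connected : Subset n → Set
  Connected S = ∃ (λ x → x ∈ S) × (∀ u v → u ∈ S → v ∈ S → Walk S u v)

  Articulation : Subset n → Fin n → Set
  Articulation S a = a ∈ S × ∃₂ (λ u v → u ∈ S × v ∈ S × u ≢ a × v ≢ a
                                  × Walk S u v × ¬ Walk (S - a) u v)

  BiConnected : Subset n → Set
  BiConnected S = Connected S × (∀ a → ¬ Articulation S a)

  Block : Subset n → Subset n → Set
  Block C B = B ⊆ C × BiConnected B
              × (∀ B′ → B ⊆ B′ → B′ ⊆ C → BiConnected B′ → B′ ⊆ B)

  LeafBlock : Subset n → Subset n → Set
  LeafBlock C B = Block C B
    × (∀ a b → a ∈ B → b ∈ B → Articulation C a → Articulation C b → a ≡ b)

  ComponentWithout : Fin n → Fin n → Subset n → Set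
  ComponentWithout s₁ s₂ C =
    s₁ ∉ C × s₂ ∉ C × Connected C
    × (∀ u v → u ∈ C → v ≢ s₁ → v ≢ s₂ → E u v → v ∈ C)

  N : Fin n → Subset n
  N s = tabulate (λ v → does (E? s v))

-- Suppose no vertex of B is adjacent to s₁ or s₂.  A vertex u of B with a
-- neighbour w in C outside B is an articulation point of C: otherwise a path
-- from w back to B avoiding u closes an ear on B, and B together with the ear
-- is a larger bi-connected subgraph of C (if B = {u}, the edge uw alone is).
-- Hence every walk leaving B leaves it through an articulation point of C
-- lying in B.  As G is connected, some walk goes from B to s₁ ∉ C, so B
-- contains an articulation point a of C, the only one since B is a leaf.  If B
-- has a second vertex v, bi-connectivity of G yields a walk from v to s₁
-- avoiding a, which would have to leave B through another articulation point;
-- if B = {a}, the edge from a into C contradicts the maximality of B.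
module Submission where

open import Defs
open import Data.Nat using (ℕ; _+_; _≥_; s≤s; z≤n)
open import Data.Nat.Properties using (≤-trans; m≤m+n; m≤n+m)
open import Data.Fin using (Fin; zero; _≟_)
open import Data.Fin.Properties using (any?)
open import Data.Fin.Subset
  using (Subset; ⊤; _∩_; _∪_; ⁅_⁆; ∣_∣; _∈_; _∉_; _⊆_; _─_; _-_; inside; outside)
open import Data.Fin.Subset.Properties
  using (_∈?_; ∈⊤; x∈⁅x⁆; x∈⁅y⁆⇒x≡y; x∉⁅y⁆⇒x≢y; x∈p∪q⁺; x∈p∪q⁻; x∈p∩q⁺; ∣p∣≤∣x∷p∣; drop-there)
open import Data.Vec using (_∷_; tabulate; here; there)
open import Data.Vec.Properties using (lookup∘tabulate; lookup⇒[]=; []=⇒lookup)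
open import Data.List using (List; []; _∷_; _++_)
open import Data.List.Membership.Propositional using () renaming (_∈_ to _∈ᴸ_; _∉_ to _∉ᴸ_)
open import Data.List.Membership.Propositional.Properties using (∈-∃++; ∈-++⁺ˡ; ∈-++⁺ʳ)
open import Data.List.Relation.Unary.Any using (here; there)
open import Data.List.Relation.Unary.All as All using (All; []; _∷_)
open import Data.List.Relation.Unary.All.Properties using (¬Any⇒All¬; ++⁻ˡ; ++⁻ʳ)
open import Data.List.Relation.Unary.AllPairs using ([]; _∷_)
open import Data.List.Relation.Unary.Unique.Propositional using (Unique)
open import Data.Product using (_×_; _,_; proj₁; proj₂; ∃)
open import Data.Sum using (_⊎_; inj₁; inj₂)
open import Data.Empty using (⊥; ⊥-elim)
open import Function using (_∘_)
open import Level using (Level)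
open import Relation.Nullary using (¬_; Dec; yes; no; does; ¬?; contradiction)
open import Relation.Nullary.Decidable using (dec-true; decidable-stable; _×-dec_; _⊎-dec_)
open import Relation.Unary using (Pred; Decidable)
open import Relation.Binary.PropositionalEquality using (_≡_; _≢_; refl; sym; trans; subst)

private
  variable
    ℓ : Level
    n : ℕ
    x y : Fin n
    p q : Subset n

x∈p─q⁺ : x ∈ p → x ∉ q → x ∈ p ─ q
x∈p─q⁺ {p = inside ∷ _} {q = outside ∷ _} here        x∉q = here
x∈p─q⁺ {p = inside ∷ _} {q = inside ∷ _}  here        x∉q = contradiction here x∉q
x∈p─q⁺ {p = _ ∷ _}      {q = _ ∷ _}       (there x∈p) x∉q = there (x∈p─q⁺ x∈p (x∉q ∘ there))

x∈p─q⁻ : ∀ (p q : Subset n) → x ∈ p ─ q → x ∈ p × x ∉ q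
x∈p─q⁻             (inside ∷ _)  (outside ∷ _) here = here , λ ()
x∈p─q⁻ {x = zero} (outside ∷ _) (inside ∷ _)  ()
x∈p─q⁻ {x = zero} (outside ∷ _) (outside ∷ _) ()
x∈p─q⁻             (_ ∷ p)       (_ ∷ q)       (there x∈p─q) with x∈p─q⁻ p q x∈p─q
... | x∈p , x∉q = there x∈p , x∉q ∘ drop-there

x∈p-y⁺ : x ∈ p → x ≢ y → x ∈ p - y
x∈p-y⁺ {y = y} x∈p x≢y = x∈p─q⁺ x∈p (x≢y ∘ x∈⁅y⁆⇒x≡y y)

x∈p-y⁻ : x ∈ p - y → x ∈ p × x ≢ y
x∈p-y⁻ {p = p} {y = y} x∈p-y with x∈p─q⁻ p ⁅ y ⁆ x∈p-y
... | x∈p , x∉⁅y⁆ = x∈p , x∉⁅y⁆⇒x≢y x∉⁅y⁆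

p⊆q⇒p-x⊆q-x : p ⊆ q → p - x ⊆ q - x
p⊆q⇒p-x⊆q-x p⊆q y∈p-x with x∈p-y⁻ y∈p-x
... | y∈p , y≢x = x∈p-y⁺ (p⊆q y∈p) y≢x

All-∈-remove : ∀ {xs} → All (_∈ p) xs → y ∉ᴸ xs → All (_∈ p - y) xs
All-∈-remove []         y∉xs = []
All-∈-remove (x∈p ∷ ps) y∉xs =
  x∈p-y⁺ x∈p (λ { refl → y∉xs (here refl) }) ∷ All-∈-remove ps (y∉xs ∘ there)

x∈p⇒∣p∣≥1 : x ∈ p → ∣ p ∣ ≥ 1
x∈p⇒∣p∣≥1               here        = s≤s z≤n
x∈p⇒∣p∣≥1 {p = s ∷ p} (there x∈p) = ≤-trans (x∈p⇒∣p∣≥1 x∈p) (∣p∣≤∣x∷p∣ s p)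

module _ {P : Pred (Fin n) ℓ} (P? : Decidable P) where

  ∈-tabulate⁺ : P x → x ∈ tabulate (does ∘ P?)
  ∈-tabulate⁺ {x = x} px = lookup⇒[]= x _ (trans (lookup∘tabulate _ x) (dec-true (P? x) px))

  ∈-tabulate⁻ : x ∈ tabulate (does ∘ P?) → P x
  ∈-tabulate⁻ {x = x} x∈ with P? x | trans (sym (lookup∘tabulate (does ∘ P?) x)) ([]=⇒lookup x∈)
  ... | yes px | _ = px
  ... | no _   | ()

Unique-++-disjoint : ∀ {A : Set} {v : A} xs {ys} → Unique (xs ++ ys) → v ∈ᴸ xs → v ∉ᴸ ys
Unique-++-disjoint (x ∷ xs) (x∉ ∷ _) (here refl) v∈ys = All.lookup x∉ (∈-++⁺ʳ xs v∈ys) refl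
Unique-++-disjoint (x ∷ xs) (_ ∷ u)  (there v∈xs)     = Unique-++-disjoint xs u v∈xs

Unique-++⁻ʳ : ∀ {A : Set} (xs : List A) {ys} → Unique (xs ++ ys) → Unique ys
Unique-++⁻ʳ []       u       = u
Unique-++⁻ʳ (_ ∷ xs) (_ ∷ u) = Unique-++⁻ʳ xs u

module _ {n : ℕ} (G : Graph n) where
  open Graph G
  open import Data.List.Membership.DecPropositional (_≟_ {n}) using () renaming (_∈?_ to _∈ᴸ?_)

  private
    variable
      S B C : Subset n
      a b t u v w z : Fin n
      qs : List (Fin n)

  ∈N : E v w → w ∈ N G v
  ∈N {v} = ∈-tabulate⁺ (E? v)

  Walk-start : Walk G S u v → u ∈ S
  Walk-start (stay u∈S)     = u∈S
  Walk-start (step u∈S _ _) = u∈S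

  Walk-end : Walk G S u v → v ∈ S
  Walk-end (stay v∈S)   = v∈S
  Walk-end (step _ _ W) = Walk-end W

  Walk-mono : S ⊆ C → Walk G S u v → Walk G C u v
  Walk-mono S⊆C (stay u∈S)     = stay (S⊆C u∈S)
  Walk-mono S⊆C (step u∈S e W) = step (S⊆C u∈S) e (Walk-mono S⊆C W)

  Walk-trans : Walk G S u v → Walk G S v w → Walk G S u w
  Walk-trans (stay _)       W′ = W′
  Walk-trans (step u∈S e W) W′ = step u∈S e (Walk-trans W W′)

  Walk-sym : Walk G S u v → Walk G S v u
  Walk-sym (stay u∈S)     = stay u∈S
  Walk-sym (step u∈S e W) = Walk-trans (Walk-sym W) (step (Walk-start W) (E-sym e) (stay u∈S))

  Walk⇒neighbour : Walk G S u v → u ≢ v → ∃ λ w → E u w × w ∈ S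
  Walk⇒neighbour (stay _)     u≢u = contradiction refl u≢u
  Walk⇒neighbour (step _ e W) _   = _ , e , Walk-start W

  data Chain : Fin n → List (Fin n) → Fin n → Set where
    edge : E u z → Chain u [] z
    _∷_  : ∀ {q} → E u q → Chain q qs z → Chain u (q ∷ qs) z

  Chain-split : ∀ pre {post} → Chain u (pre ++ v ∷ post) z → Chain u pre v × Chain v post z
  Chain-split []        (e ∷ c) = edge e , c
  Chain-split (_ ∷ pre) (e ∷ c) with Chain-split pre c
  ... | c₁ , c₂ = e ∷ c₁ , c₂

  Chain⇒Walk : Chain u qs z → u ∈ S → All (_∈ S) qs → z ∈ S → Walk G S u z
  Chain⇒Walk (edge e) u∈S []           z∈S = step u∈S e (stay z∈S)
  Chain⇒Walk (e ∷ c)  u∈S (q∈S ∷ qs∈S) z∈S = step u∈S e (Chain⇒Walk c q∈S qs∈S z∈S)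

  Chain-reach : Chain u qs z → u ∈ S → All (_∈ S) qs → v ∈ᴸ qs → Walk G S v u
  Chain-reach c u∈S qs∈S v∈qs with ∈-∃++ v∈qs
  ... | pre , _ , refl =
    Walk-sym (Chain⇒Walk (proj₁ (Chain-split pre c)) u∈S (++⁻ˡ pre qs∈S) (All.lookup qs∈S v∈qs))

  -- On a simple chain, a vertex a occurs at most once, so every interior
  -- vertex other than a reaches one of the two ends without passing a.
  Chain-reach-avoiding : Chain u qs z → Unique qs → u ∉ᴸ qs → z ∉ᴸ qs → u ≢ z
    → u ∈ S → z ∈ S → All (_∈ S) qs → v ∈ᴸ qs → v ≢ a
    → Walk G (S - a) v u ⊎ Walk G (S - a) v z
  Chain-reach-avoiding {u = u} {z = z} {S = S} {v = v} {a = a}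
    c uniq u∉qs z∉qs u≢z u∈S z∈S qs∈S v∈qs v≢a with ∈-∃++ v∈qs
  ... | pre , post , refl = go (a ∈ᴸ? post) (a ≟ z)
    where
    chains : Chain u pre v × Chain v post z
    chains = Chain-split pre c

    v∈S-a : v ∈ S - a
    v∈S-a = x∈p-y⁺ (All.lookup qs∈S v∈qs) v≢a

    backward : a ∉ᴸ pre → u ≢ a → Walk G (S - a) v u
    backward a∉pre u≢a = Walk-sym (Chain⇒Walk (proj₁ chains) (x∈p-y⁺ u∈S u≢a)
      (All-∈-remove (++⁻ˡ pre qs∈S) a∉pre) v∈S-a)

    go : Dec (a ∈ᴸ post) → Dec (a ≡ z) → Walk G (S - a) v u ⊎ Walk G (S - a) v z
    go (no a∉post) (no a≢z) = inj₂ (Chain⇒Walk (proj₂ chains) v∈S-a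
      (All-∈-remove (++⁻ʳ (v ∷ []) (++⁻ʳ pre qs∈S)) a∉post) (x∈p-y⁺ z∈S (a≢z ∘ sym)))
    go (yes a∈post) _ = inj₁ (backward
      (λ a∈pre → Unique-++-disjoint pre uniq a∈pre (there a∈post))
      (λ { refl → u∉qs (∈-++⁺ʳ pre (there a∈post)) }))
    go (no _) (yes refl) = inj₁ (backward (z∉qs ∘ ∈-++⁺ˡ) u≢z)

  record PathInto (S B : Subset n) (x : Fin n) : Set where
    constructor pathInto
    field
      {target}   : Fin n
      {interior} : List (Fin n)
      target∈B   : target ∈ B
      target∈S   : target ∈ S
      chain      : Chain x interior target
      simple     : Unique (x ∷ interior)
      outsideB   : All (_∉ B) (x ∷ interior)
      insideS    : All (_∈ S) (x ∷ interior)

  Walk⇒PathInto : Walk G S v t → v ∉ B → t ∈ B → PathInto S B v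
  Walk⇒PathInto (stay _) v∉B t∈B = contradiction t∈B v∉B
  Walk⇒PathInto {v = v} {B = B} (step {w = w} v∈S e W) v∉B t∈B with w ∈? B
  ... | yes w∈B = pathInto w∈B (Walk-start W) (edge e) ([] ∷ []) (v∉B ∷ []) (v∈S ∷ [])
  ... | no w∉B with Walk⇒PathInto W w∉B t∈B
  ... | pathInto {interior = qs} z∈B z∈S c uniq outB inS with v ∈ᴸ? qs
  ...   | yes v∈qs with ∈-∃++ v∈qs
  ...     | pre , _ , refl = pathInto z∈B z∈S (proj₂ (Chain-split pre c))
    (Unique-++⁻ʳ (w ∷ pre) uniq) (++⁻ʳ (w ∷ pre) outB) (++⁻ʳ (w ∷ pre) inS)
  Walk⇒PathInto (step v∈S e W) v∉B t∈B
    | no w∉B | pathInto z∈B z∈S c uniq outB inS | no v∉qs =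
    pathInto z∈B z∈S (e ∷ c) (((λ { refl → E-irr e }) ∷ ¬Any⇒All¬ _ v∉qs) ∷ uniq)
      (v∉B ∷ outB) (v∈S ∷ inS)

  BiConnected⇒¬¬Walk-avoiding : BiConnected G B → B ⊆ S → b ∈ B → v ∈ B → b ≢ a → v ≢ a
    → ¬ ¬ Walk G (S - a) b v
  BiConnected⇒¬¬Walk-avoiding {B = B} {a = a} ((_ , conB) , noArtB) B⊆S b∈B v∈B b≢a v≢a ¬W
    with a ∈? B
  ... | yes a∈B = noArtB a (a∈B , _ , _ , b∈B , v∈B , b≢a , v≢a , conB _ _ b∈B v∈B ,
                            ¬W ∘ Walk-mono (p⊆q⇒p-x⊆q-x B⊆S))
  ... | no a∉B = ¬W (Walk-mono (λ x∈B → x∈p-y⁺ (B⊆S x∈B) (λ { refl → a∉B x∈B }))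
                              (conB _ _ b∈B v∈B))

  BiConnected-edge : E u w → BiConnected G (⁅ u ⁆ ∪ ⁅ w ⁆)
  BiConnected-edge {u} {w} e =
    ((u , x∈p∪q⁺ (inj₁ (x∈⁅x⁆ u))) , λ x y x∈ y∈ → walk x∈ y∈ x∈ y∈) ,
    λ { a (_ , x , y , x∈ , y∈ , x≢a , y≢a , _ , ¬W) →
          ¬W (walk x∈ y∈ (x∈p-y⁺ x∈ x≢a) (x∈p-y⁺ y∈ y≢a)) }
    where
    ends : x ∈ ⁅ u ⁆ ∪ ⁅ w ⁆ → x ≡ u ⊎ x ≡ w
    ends x∈ with x∈p∪q⁻ ⁅ u ⁆ ⁅ w ⁆ x∈
    ... | inj₁ x∈⁅u⁆ = inj₁ (x∈⁅y⁆⇒x≡y u x∈⁅u⁆)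
    ... | inj₂ x∈⁅w⁆ = inj₂ (x∈⁅y⁆⇒x≡y w x∈⁅w⁆)

    walk : x ∈ ⁅ u ⁆ ∪ ⁅ w ⁆ → y ∈ ⁅ u ⁆ ∪ ⁅ w ⁆ → x ∈ S → y ∈ S → Walk G S x y
    walk x∈ y∈ x∈S y∈S with ends x∈ | ends y∈
    ... | inj₁ refl | inj₁ refl = stay x∈S
    ... | inj₂ refl | inj₂ refl = stay x∈S
    ... | inj₁ refl | inj₂ refl = step x∈S e (stay y∈S)
    ... | inj₂ refl | inj₁ refl = step x∈S (E-sym e) (stay y∈S)

  _∪ᴸ_ : Subset n → List (Fin n) → Subset n
  B ∪ᴸ qs = tabulate (does ∘ λ v → v ∈? B ⊎-dec v ∈ᴸ? qs)

  ∈-∪ᴸ⁺ : ∀ B qs → v ∈ B ⊎ v ∈ᴸ qs → v ∈ B ∪ᴸ qs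
  ∈-∪ᴸ⁺ B qs = ∈-tabulate⁺ (λ v → v ∈? B ⊎-dec v ∈ᴸ? qs)

  ∈-∪ᴸ⁻ : ∀ B qs → v ∈ B ∪ᴸ qs → v ∈ B ⊎ v ∈ᴸ qs
  ∈-∪ᴸ⁻ B qs = ∈-tabulate⁻ (λ v → v ∈? B ⊎-dec v ∈ᴸ? qs)

  BiConnected-ear : BiConnected G B → u ∈ B → z ∈ B → u ≢ z
    → Chain u qs z → Unique qs → All (_∉ B) qs → BiConnected G (B ∪ᴸ qs)
  BiConnected-ear {B = B} {u = u} {z = z} {qs = qs}
    biB@((_ , conB) , _) u∈B z∈B u≢z c uniq qs∉B =
    ((u , B⊆B′ u∈B) , λ x y x∈ y∈ → Walk-trans (reach-u x∈) (Walk-sym (reach-u y∈))) ,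
    no-articulation
    where
    B′ : Subset n
    B′ = B ∪ᴸ qs

    B⊆B′ : B ⊆ B′
    B⊆B′ = ∈-∪ᴸ⁺ B qs ∘ inj₁

    qs⊆B′ : All (_∈ B′) qs
    qs⊆B′ = All.tabulate (∈-∪ᴸ⁺ B qs ∘ inj₂)

    ∉qs : v ∈ B → v ∉ᴸ qs
    ∉qs v∈B v∈qs = All.lookup qs∉B v∈qs v∈B

    reach-u : x ∈ B′ → Walk G B′ x u
    reach-u {x} x∈ with ∈-∪ᴸ⁻ B qs x∈
    ... | inj₁ x∈B  = Walk-mono B⊆B′ (conB x u x∈B u∈B)
    ... | inj₂ x∈qs = Chain-reach c (B⊆B′ u∈B) qs⊆B′ x∈qs

    reach-B-avoiding : x ∈ B′ → x ≢ a → ¬ ¬ (∃ λ b → b ∈ B × b ≢ a × Walk G (B′ - a) x b)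
    reach-B-avoiding {x} x∈ x≢a k with ∈-∪ᴸ⁻ B qs x∈
    ... | inj₁ x∈B  = k (x , x∈B , x≢a , stay (x∈p-y⁺ x∈ x≢a))
    ... | inj₂ x∈qs with Chain-reach-avoiding c uniq (∉qs u∈B) (∉qs z∈B) u≢z
                           (B⊆B′ u∈B) (B⊆B′ z∈B) qs⊆B′ x∈qs x≢a
    ...   | inj₁ W = k (u , u∈B , proj₂ (x∈p-y⁻ (Walk-end W)) , W)
    ...   | inj₂ W = k (z , z∈B , proj₂ (x∈p-y⁻ (Walk-end W)) , W)

    no-articulation : ∀ a → ¬ Articulation G B′ a
    no-articulation a (_ , x , y , x∈ , y∈ , x≢a , y≢a , _ , ¬W) =
      reach-B-avoiding x∈ x≢a λ { (b , b∈B , b≢a , Wx) →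
      reach-B-avoiding y∈ y≢a λ { (b′ , b′∈B , b′≢a , Wy) →
      BiConnected⇒¬¬Walk-avoiding biB B⊆B′ b∈B b′∈B b≢a b′≢a
        (λ W → ¬W (Walk-trans Wx (Walk-trans W (Walk-sym Wy)))) } }

  Block-no-ear : Block G C B → u ∈ B → z ∈ B → u ≢ z → ∀ {q} → Chain u (q ∷ qs) z
    → Unique (q ∷ qs) → All (_∉ B) (q ∷ qs) → All (_∈ C) (q ∷ qs) → ⊥
  Block-no-ear {C = C} {B = B} {qs = qs} (B⊆C , biB , maxB)
    u∈B z∈B u≢z {q} c uniq q∷qs∉B@(q∉B ∷ _) q∷qs∈C =
    q∉B (maxB B′ (∈-∪ᴸ⁺ B (q ∷ qs) ∘ inj₁) B′⊆C
              (BiConnected-ear biB u∈B z∈B u≢z c uniq q∷qs∉B)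
              (∈-∪ᴸ⁺ B (q ∷ qs) (inj₂ (here refl))))
    where
    B′ : Subset n
    B′ = B ∪ᴸ (q ∷ qs)

    B′⊆C : B′ ⊆ C
    B′⊆C v∈ with ∈-∪ᴸ⁻ B (q ∷ qs) v∈
    ... | inj₁ v∈B  = B⊆C v∈B
    ... | inj₂ v∈qs = All.lookup q∷qs∈C v∈qs

  Block-no-pendant-edge : Block G C B → u ∈ B → ¬ (∃ λ y → y ∈ B × y ≢ u)
    → w ∈ C → w ∉ B → E u w → ⊥
  Block-no-pendant-edge {C = C} {B = B} {u = u} {w = w} (B⊆C , _ , maxB) u∈B ∄other w∈C w∉B e =
    w∉B (maxB (⁅ u ⁆ ∪ ⁅ w ⁆) B⊆edge edge⊆C (BiConnected-edge e) (x∈p∪q⁺ (inj₂ (x∈⁅x⁆ w))))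
    where
    B⊆edge : B ⊆ ⁅ u ⁆ ∪ ⁅ w ⁆
    B⊆edge {y} y∈B = subst (_∈ ⁅ u ⁆ ∪ ⁅ w ⁆)
      (sym (decidable-stable (y ≟ u) λ y≢u → ∄other (y , y∈B , y≢u)))
      (x∈p∪q⁺ (inj₁ (x∈⁅x⁆ u)))

    edge⊆C : ⁅ u ⁆ ∪ ⁅ w ⁆ ⊆ C
    edge⊆C y∈ with x∈p∪q⁻ ⁅ u ⁆ ⁅ w ⁆ y∈
    ... | inj₁ y∈⁅u⁆ = subst (_∈ C) (sym (x∈⁅y⁆⇒x≡y u y∈⁅u⁆)) (B⊆C u∈B)
    ... | inj₂ y∈⁅w⁆ = subst (_∈ C) (sym (x∈⁅y⁆⇒x≡y w y∈⁅w⁆)) w∈C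

  Block-attachment⇒Articulation : Block G C B → Connected G C
    → u ∈ B → w ∈ C → w ∉ B → E u w → Articulation G C u
  Block-attachment⇒Articulation {C = C} {B = B} {u = u} {w = w}
    blk@(B⊆C , _) (_ , conC) u∈B w∈C w∉B e with any? (λ y → y ∈? B ×-dec ¬? (y ≟ u))
  ... | no ∄other = ⊥-elim (Block-no-pendant-edge blk u∈B ∄other w∈C w∉B e)
  ... | yes (y , y∈B , y≢u) =
    B⊆C u∈B , w , y , w∈C , B⊆C y∈B , (λ { refl → w∉B u∈B }) , y≢u ,
    conC w y w∈C (B⊆C y∈B) , no-detour
    where
    no-detour : ¬ Walk G (C - u) w y
    no-detour W with Walk⇒PathInto W w∉B y∈B
    ... | pathInto z∈B z∈C-u c uniq outB inS =
      Block-no-ear blk u∈B z∈B (proj₂ (x∈p-y⁻ z∈C-u) ∘ sym) (e ∷ c) uniq outB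
        (All.map (proj₁ ∘ x∈p-y⁻) inS)

  Walk-leaving-block : ∀ {s₁ s₂} → ComponentWithout G s₁ s₂ C → Block G C B
    → (∀ x → x ∈ B → ¬ (E s₁ x ⊎ E s₂ x))
    → Walk G S v t → v ∈ B → t ∉ B → ∃ λ a → a ∈ S × a ∈ B × Articulation G C a
  Walk-leaving-block _ _ _ (stay _) v∈B t∉B = contradiction v∈B t∉B
  Walk-leaving-block {C = C} {B = B} comp@(_ , _ , conC , closed) blk@(B⊆C , _) isolated
    (step {u = v} {w = w} v∈S e W) v∈B t∉B with w ∈? B
  ... | yes w∈B = Walk-leaving-block comp blk isolated W w∈B t∉B
  ... | no w∉B  = v , v∈S , v∈B , Block-attachment⇒Articulation blk conC v∈B w∈C w∉B e
    where
    w∈C : w ∈ C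
    w∈C = closed v w (B⊆C v∈B)
      (λ { refl → isolated v v∈B (inj₁ (E-sym e)) })
      (λ { refl → isolated v v∈B (inj₂ (E-sym e)) }) e

  LeafBlock⇒¬isolated : BiConnected G ⊤ → ∀ {s₁ s₂}
    → ComponentWithout G s₁ s₂ C → LeafBlock G C B
    → ¬ (∀ x → x ∈ B → ¬ (E s₁ x ⊎ E s₂ x))
  LeafBlock⇒¬isolated {B = B} ((_ , conG) , noArtG) {s₁}
    comp@(s₁∉C , _ , (_ , conC) , _) (blk@(B⊆C , (((x , x∈B) , _) , _) , _) , leaf) isolated
    with Walk-leaving-block comp blk isolated (conG x s₁ ∈⊤ ∈⊤) x∈B (s₁∉C ∘ B⊆C)
  ... | a , _ , a∈B , art-a@(a∈C , p , _ , p∈C , _ , p≢a , _)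
    with any? (λ v → v ∈? B ×-dec ¬? (v ≟ a))
  ...   | yes (v , v∈B , v≢a) =
    noArtG a (∈⊤ , v , s₁ , ∈⊤ , ∈⊤ , v≢a , (λ { refl → s₁∉C a∈C }) , conG v s₁ ∈⊤ ∈⊤ , no-detour)
    where
    no-detour : ¬ Walk G (⊤ - a) v s₁
    no-detour W with Walk-leaving-block comp blk isolated W v∈B (s₁∉C ∘ B⊆C)
    ... | y , y∈⊤-a , y∈B , art-y = proj₂ (x∈p-y⁻ y∈⊤-a) (leaf y a y∈B a∈B art-y art-a)
  ...   | no ∄other with Walk⇒neighbour (conC a p a∈C p∈C) (p≢a ∘ sym)
  ...     | w , e , w∈C =
    Block-no-pendant-edge blk a∈B ∄other w∈C (λ w∈B → ∄other (w , w∈B , λ { refl → E-irr e })) e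

lemma3 : ∀ {n} (G : Graph n) → BiConnected G ⊤
    → (s₁ s₂ : Fin n) → Graph.E G s₁ s₂
    → (C : Subset n) → ComponentWithout G s₁ s₂ C
    → (B : Subset n) → LeafBlock G C B
    → ∣ B ∩ N G s₁ ∣ + ∣ B ∩ N G s₂ ∣ ≥ 1
lemma3 G bic s₁ s₂ _ C comp B leaf
  with any? (λ x → x ∈? B ×-dec (Graph.E? G s₁ x ⊎-dec Graph.E? G s₂ x))
... | yes (x , x∈B , inj₁ e) = ≤-trans (x∈p⇒∣p∣≥1 (x∈p∩q⁺ (x∈B , ∈N G e))) (m≤m+n _ _)
... | yes (x , x∈B , inj₂ e) = ≤-trans (x∈p⇒∣p∣≥1 (x∈p∩q⁺ (x∈B , ∈N G e))) (m≤n+m _ _)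
... | no ∄adjacent =
  ⊥-elim (LeafBlock⇒¬isolated G bic comp leaf λ x x∈B e → ∄adjacent (x , x∈B , e))
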